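{- Let $q,n$ be positive integers and let $h:\mathcal{E}_q(n)\to\mathbb{C}$ be an arbitrary function. Then \[ \sum_{t\in\mathcal{E}_q(n)}h(t)=\sum_{\substack{\pi\in\Pi_{2q}\\ \pi\text{ even}}}\;\sum_{\substack{t\in\mathcal{E}_q(n)\\ t\prec\pi}}h(t)\prod_{B\in\pi}T\!\left(\tfrac12|B|\right). \]
   Context: A tuple $(t_1,\dots,t_{2q})$ is even if there is a permutation $\sigma$ of $\{1,\dots,2q\}$ with $t_{\sigma(2k-1)}=t_{\sigma(2k)}$ for all $k\in\{1,\dots,q\}$; $\mathcal{E}_q(n)$ is the set of even tuples in $(\mathbb{Z}/n\mathbb{Z})^{2q}$. $\Pi_{m}$ is the set of set partitions of $\{1,\dots,m\}$ (elements called blocks); a partition is even if all blocks have even cardinality. For $t\in(\mathbb{Z}/n\mathbb{Z})^m$ and $\pi\in\Pi_m$, $t\prec\pi$ means $t_j=t_k$ whenever $j,k$ lie in the same block of $\pi$. The signed tangent numbers $T(k)$ are defined by $\log\cosh(z)=\sum_{k\ge1}\frac{T(k)}{(2k)!}z^{2k}$ for $|z|<\pi/2$. -}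

module Defs where

open import Level using (Level)
open import Data.Nat as ℕ using (ℕ; zero; suc; ⌊_/2⌋)
open import Data.Nat.Combinatorics using (_C_)
open import Data.Nat.Divisibility using (_∣_; _∣?_)
open import Data.Integer as ℤ using (ℤ; +_; -[1+_])
open import Data.Fin as Fin using (Fin; zero; suc; combine; fromℕ; inject₁)
open import Data.Fin.Properties using (all?; _≟_)
open import Data.Fin.Permutation using (Permutation′; _⟨$⟩ʳ_)
open import Data.Vec as Vec using (Vec; []; _∷ʳ_)
open import Data.Vec.Functional using () renaming (_∷_ to _◂_)
open import Data.List as List using (List; []; _∷_; [_]; _++_; map; concatMap; allFin; foldr; upTo)
open import Data.Bool using (if_then_else_)
open import Data.Nat.ListAction using () renaming (sum to sumℕ)
open import Relation.Nullary using (Dec; does; ¬_)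
open import Relation.Nullary.Decidable using (_→-dec_)
open import Relation.Binary.PropositionalEquality using (_≡_; refl)
open import Algebra.Bundles using (CommutativeRing)

-- Signed tangent numbers T(k).
-- log cosh z = Σ_{k≥1} T(k) z^{2k}/(2k)!.  Differentiating, cosh·(log cosh)' = sinh,
-- and comparing coefficients of z^{2m-1} gives  Σ_{k=1}^{m} C(2m-1,2k-1) T(k) = 1,
-- i.e. T(m) = 1 - Σ_{k=1}^{m-1} C(2m-1,2k-1) T(k).

sumℤ : List ℤ → ℤ
sumℤ = foldr ℤ._+_ (+ 0)

-- Ts m = [T(1), …, T(m)]
Ts : (m : ℕ) → Vec ℤ m
Ts zero    = []
Ts (suc m) = Ts m ∷ʳ (+ 1 ℤ.- sumℤ (map (λ i → + ((2 ℕ.* m ℕ.+ 1) C (2 ℕ.* Fin.toℕ i ℕ.+ 1)) ℤ.* Vec.lookup (Ts m) i) (allFin m)))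

T : ℕ → ℤ
T zero    = + 0          -- T(0) never used
T (suc m) = Vec.last (Ts (suc m))

-- sanity checks (tanh z = z - z³/3 + 2z⁵/15 - 17z⁷/315 + …)
private
  T1 : T 1 ≡ + 1
  T1 = refl
  T2 : T 2 ≡ -[1+ 1 ]
  T2 = refl
  T3 : T 3 ≡ + 16
  T3 = refl
  T4 : T 4 ≡ -[1+ 271 ]
  T4 = refl

-- Tuples in (ℤ/nℤ)^{2q}: functions Fin (q * 2) → Fin n (only equality of entries matters).
-- Positions 2k-1, 2k (1-based, k = 1..q) are  combine k 0, combine k 1  (0-based: 2k, 2k+1).

Tuple : ℕ → ℕ → Set
Tuple q n = Fin (q ℕ.* 2) → Fin n

IsEvenTuple : ∀ {q n} → Tuple q n → Set
IsEvenTuple {q} t = Σ' where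
  Σ' : Set
  Σ' = Data.Product.∃ λ (σ : Permutation′ (q ℕ.* 2)) →
         ∀ (k : Fin q) → t (σ ⟨$⟩ʳ combine k zero) ≡ t (σ ⟨$⟩ʳ combine k (suc zero))
    where import Data.Product

allFuns : (m n : ℕ) → List (Fin m → Fin n)
allFuns zero    n = [ (λ ()) ]
allFuns (suc m) n = concatMap (λ a → map (λ g → a ◂ g) (allFuns m n)) (allFin n)

-- Set partitions of {0,…,m-1} with k blocks, encoded canonically:
-- built by adding elements one at a time, each either into an existing block
-- (blocks numbered in order of creation) or as a new singleton block.
data SetPartition : ℕ → ℕ → Set where
  ∅   : SetPartition zero zero
  old : ∀ {m k} → SetPartition m k → Fin k → SetPartition (suc m) k
  new : ∀ {m k} → SetPartition m k → SetPartition (suc m) (suc k)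

block : ∀ {m k} → SetPartition m k → Fin m → Fin k
block (old π j) zero    = j
block (old π j) (suc i) = block π i
block (new {k = k} π) zero    = fromℕ k
block (new π) (suc i) = inject₁ (block π i)

allPartitions : (m k : ℕ) → List (SetPartition m k)
allPartitions zero    zero    = [ ∅ ]
allPartitions zero    (suc k) = []
allPartitions (suc m) zero    = []
allPartitions (suc m) (suc k) =
  map new (allPartitions m k) ++ concatMap (λ π → map (old π) (allFin (suc k))) (allPartitions m (suc k))

blockSize : ∀ {m k} → SetPartition m k → Fin k → ℕ
blockSize {m} π j = sumℕ (map (λ i → if does (block π i ≟ j) then 1 else 0) (allFin m))

IsEvenPartition : ∀ {m k} → SetPartition m k → Set
IsEvenPartition {k = k} π = ∀ (j : Fin k) → 2 ∣ blockSize π j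

isEvenPartition? : ∀ {m k} (π : SetPartition m k) → Dec (IsEvenPartition π)
isEvenPartition? π = all? (λ j → 2 ∣? blockSize π j)

_≺_ : ∀ {m n k} → (Fin m → Fin n) → SetPartition m k → Set
_≺_ {m} t π = ∀ (i j : Fin m) → block π i ≡ block π j → t i ≡ t j

≺? : ∀ {m n k} (t : Fin m → Fin n) (π : SetPartition m k) → Dec (t ≺ π)
≺? t π = all? λ i → all? λ j → (block π i ≟ block π j) →-dec (t i ≟ t j)

module _ {c ℓ : Level} (R : CommutativeRing c ℓ) where
  open CommutativeRing R

  ℕ→R : ℕ → Carrier
  ℕ→R zero    = 0#
  ℕ→R (suc n) = 1# + ℕ→R n

  ℤ→R : ℤ → Carrier
  ℤ→R (+ n)      = ℕ→R n
  ℤ→R -[1+ n ]   = - ℕ→R (suc n)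

  ∑ : List Carrier → Carrier
  ∑ = foldr _+_ 0#

  ∏ : List Carrier → Carrier
  ∏ = foldr _*_ 1#

  ∑[_∣_]_ : ∀ {a p} {A : Set a} {P : A → Set p} → List A → ((x : A) → Dec (P x)) → (A → Carrier) → Carrier
  ∑[ xs ∣ P? ] f = ∑ (map (λ x → if does (P? x) then f x else 0#) xs)

  ∑Partitions : ∀ m → (∀ {k} → SetPartition m k → Carrier) → Carrier
  ∑Partitions m F = ∑ (map (λ k → ∑ (map F (allPartitions m k))) (upTo (suc m)))

  ∏T : ∀ {m k} → SetPartition m k → Carrier
  ∏T {k = k} π = ∏ (map (λ j → ℤ→R (T ⌊ blockSize π j /2⌋)) (allFin k))

{-# OPTIONS --safe #-}
module Submission where

-- Swapping the two sums, it suffices that for every even tuple t the even partitions π with t ≺ π,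
-- i.e. those all of whose blocks are monochromatic for t, satisfy ∑ ∏_{B ∈ π} T(|B|/2) = 1.
-- This sum is a partition function of the colour sequence t: a block weighs T(|B|/2) if it is
-- monochromatic of even size and 0 otherwise. Condition on the block of the first element c, which
-- consists of c and a subset S of the remaining elements: it contributes only if S is coloured c
-- and |S| is odd, and then the remaining elements again have even multiplicities, so by induction
-- they contribute 1. If 2m+1 further elements have colour c, what is left is ∑_j C(2m+1, j) w(j+1),
-- where w(s) is T(s/2) for even s and 0 for odd s, that is ∑_k C(2m+1, 2k-1) T(k), which is 1 by
-- the recursion defining T.

open import Defs
open import Level using (Level)
open import Data.Bool as Bool using (Bool; true; false; if_then_else_; _∧_)
open import Data.Empty using (⊥-elim)
open import Data.Fin as Fin using (Fin; zero; suc; toℕ; fromℕ; inject₁)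
import Data.Fin.Properties as Fin
open import Data.Fin.Properties using (_≟_)
open import Data.Fin.Relation.Unary.Top using (view; ‵fromℕ; ‵inject₁)
open import Data.List as List using (List; []; _∷_; _++_; [_]; map; concatMap; allFin; tabulate; upTo; applyUpTo; length; _ʳ++_)
open import Data.List.Membership.Propositional using (_∈_)
open import Data.List.Membership.Propositional.Properties using (∈-allFin)
open import Data.List.Relation.Unary.Any using (here; there)
open import Data.List.Relation.Unary.All as All using (All; []; _∷_)
import Data.List.Relation.Unary.All.Properties as All
open import Data.Nat.ListAction using () renaming (sum to sumℕ)
import Data.List.Properties as List
open import Data.Nat as ℕ using (ℕ; zero; suc; _≤_; _<_; s≤s; z≤n; ⌊_/2⌋)
import Data.Nat.Properties as ℕ
import Algebra.Properties.CommutativeSemigroup ℕ.+-commutativeSemigroup as ℕ+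
open import Algebra.Properties.CommutativeMonoid.Sum ℕ.+-0-commutativeMonoid as ℕΣ using (sum)
open import Data.Nat.Combinatorics using (_C_; nCn≡1; nCk+nC[k+1]≡[n+1]C[k+1]; k>n⇒nCk≡0)
open import Data.Nat.Divisibility using (_∣_; _∣?_; divides; ∣1⇒≡1; ∣m+n∣m⇒∣n)
open import Data.Integer as ℤ using (ℤ; +_; -[1+_])
import Data.Integer.Properties as ℤ
open import Data.Product as Product using (_×_; _,_; proj₁; proj₂; ∃)
open import Data.Vec as Vec using (Vec; []; _∷_; _∷ʳ_; lookup; updateAt)
import Data.Vec.Properties as Vec
open import Function using (_∘_; id)
open import Data.Fin.Permutation using (_⟨$⟩ʳ_)
open import Relation.Nullary using (Dec; does; yes; no; ¬_)
open import Relation.Nullary.Decidable using (dec-true; dec-false; _×-dec_)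
open import Relation.Binary.PropositionalEquality as ≡ using (_≡_; _≢_)
open import Algebra.Bundles using (CommutativeRing)

private
  variable
    a : Level
    A B : Set a
    k m : ℕ

map-allFin-suc : (f : Fin (suc k) → A) → map f (allFin (suc k)) ≡ f zero ∷ map (f ∘ suc) (allFin k)
map-allFin-suc f = ≡.trans (List.map-tabulate id f) (≡.cong (f zero ∷_) (≡.sym (List.map-tabulate id (f ∘ suc))))

map-upTo-suc : ∀ {N} (f : ℕ → A) → map f (upTo (suc N)) ≡ f 0 ∷ map (f ∘ suc) (upTo N)
map-upTo-suc {N = N} f = ≡.trans (List.map-upTo f (suc N)) (≡.cong (f 0 ∷_) (≡.sym (List.map-upTo (f ∘ suc) N)))

map-allFin-toℕ : (f : ℕ → A) → map (f ∘ toℕ) (allFin k) ≡ map f (upTo k)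
map-allFin-toℕ {k = k} f = ≡.trans (List.map-tabulate id (f ∘ toℕ)) (≡.trans (tabulate-toℕ k f) (≡.sym (List.map-upTo f k)))
  where
  tabulate-toℕ : ∀ k (f : ℕ → A) → tabulate {n = k} (f ∘ toℕ) ≡ applyUpTo f k
  tabulate-toℕ zero    f = ≡.refl
  tabulate-toℕ (suc k) f = ≡.cong (f 0 ∷_) (tabulate-toℕ k (f ∘ suc))

lookup-∷ʳ-fromℕ : (xs : Vec A k) (x : A) → lookup (xs ∷ʳ x) (fromℕ k) ≡ x
lookup-∷ʳ-fromℕ []       x = ≡.refl
lookup-∷ʳ-fromℕ (y ∷ xs) x = lookup-∷ʳ-fromℕ xs x

lookup-∷ʳ-inject₁ : (xs : Vec A k) (x : A) (j : Fin k) → lookup (xs ∷ʳ x) (inject₁ j) ≡ lookup xs j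
lookup-∷ʳ-inject₁ (y ∷ xs) x zero    = ≡.refl
lookup-∷ʳ-inject₁ (y ∷ xs) x (suc j) = lookup-∷ʳ-inject₁ xs x j

splits : List A → List (List A × List A)
splits []      = [ ([] , []) ]
splits (x ∷ l) = map (Product.map₁ (x ∷_)) (splits l) ++ map (Product.map₂ (x ∷_)) (splits l)

2∣suc⇒odd : ∀ {N} → 2 ∣ suc N → ∃ λ m → N ≡ suc (m ℕ.* 2)
2∣suc⇒odd (divides (suc m) eq) = m , ℕ.suc-injective eq

2∤1+n*2 : ∀ n → ¬ 2 ∣ suc (n ℕ.* 2)
2∤1+n*2 n 2∣1+2n with ∣1⇒≡1 (∣m+n∣m⇒∣n (≡.subst (2 ∣_) (ℕ.+-comm 1 (n ℕ.* 2)) 2∣1+2n) (divides n ≡.refl))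
... | ()

2∣n+n : ∀ n → 2 ∣ n ℕ.+ n
2∣n+n n = divides n (≡.trans (≡.cong (n ℕ.+_) (≡.sym (ℕ.+-identityʳ n))) (ℕ.*-comm 2 n))

⌊n*2/2⌋≡n : ∀ n → ⌊ n ℕ.* 2 /2⌋ ≡ n
⌊n*2/2⌋≡n zero    = ≡.refl
⌊n*2/2⌋≡n (suc n) = ≡.cong suc (⌊n*2/2⌋≡n n)

module Sums {c ℓ} (R : CommutativeRing c ℓ) where
  open CommutativeRing R hiding (zero)
  open import Relation.Binary.Reasoning.Setoid setoid
  open import Algebra.Properties.CommutativeSemigroup +-commutativeSemigroup using (interchange)

  ∑-over : List A → (A → Carrier) → Carrier
  ∑-over xs f = ∑ R (map f xs)
  syntax ∑-over xs (λ x → e) = ∑[ x ← xs ] e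

  ∏-over : List A → (A → Carrier) → Carrier
  ∏-over xs f = ∏ R (map f xs)
  syntax ∏-over xs (λ x → e) = ∏[ x ← xs ] e

  ∑-cong : ∀ (xs : List A) {f g : A → Carrier} → (∀ x → f x ≈ g x) → ∑[ x ← xs ] f x ≈ ∑[ x ← xs ] g x
  ∑-cong []       f≈g = refl
  ∑-cong (x ∷ xs) f≈g = +-cong (f≈g x) (∑-cong xs f≈g)

  ∑-zero : ∀ (xs : List A) → ∑[ x ← xs ] 0# ≈ 0#
  ∑-zero []       = refl
  ∑-zero (x ∷ xs) = trans (+-identityˡ _) (∑-zero xs)

  ∑-++ : ∀ (xs ys : List A) (f : A → Carrier) → ∑[ x ← xs ++ ys ] f x ≈ ∑[ x ← xs ] f x + ∑[ y ← ys ] f y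
  ∑-++ []       ys f = sym (+-identityˡ _)
  ∑-++ (x ∷ xs) ys f = trans (+-congˡ (∑-++ xs ys f)) (sym (+-assoc _ _ _))

  ∑-map : ∀ (xs : List A) (g : A → B) (f : B → Carrier) → ∑[ y ← map g xs ] f y ≡ ∑[ x ← xs ] f (g x)
  ∑-map xs g f = ≡.cong (∑ R) (≡.sym (List.map-∘ xs))

  ∑-concatMap : ∀ (xs : List A) (g : A → List B) (f : B → Carrier) →
                ∑[ y ← concatMap g xs ] f y ≈ ∑[ x ← xs ] ∑[ y ← g x ] f y
  ∑-concatMap []       g f = refl
  ∑-concatMap (x ∷ xs) g f = trans (∑-++ (g x) _ f) (+-congˡ (∑-concatMap xs g f))

  ∑-distrib-+ : ∀ (xs : List A) (f g : A → Carrier) → ∑[ x ← xs ] (f x + g x) ≈ ∑[ x ← xs ] f x + ∑[ x ← xs ] g x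
  ∑-distrib-+ []       f g = sym (+-identityʳ 0#)
  ∑-distrib-+ (x ∷ xs) f g = trans (+-congˡ (∑-distrib-+ xs f g)) (interchange _ _ _ _)

  *-distribˡ-∑ : ∀ (xs : List A) (a : Carrier) (f : A → Carrier) → a * ∑[ x ← xs ] f x ≈ ∑[ x ← xs ] (a * f x)
  *-distribˡ-∑ []       a f = zeroʳ a
  *-distribˡ-∑ (x ∷ xs) a f = trans (distribˡ a _ _) (+-congˡ (*-distribˡ-∑ xs a f))

  ∑-comm : ∀ (xs : List A) (ys : List B) (F : A → B → Carrier) →
           ∑[ x ← xs ] ∑[ y ← ys ] F x y ≈ ∑[ y ← ys ] ∑[ x ← xs ] F x y
  ∑-comm []       ys F = sym (∑-zero ys)
  ∑-comm (x ∷ xs) ys F = trans (+-congˡ (∑-comm xs ys F)) (sym (∑-distrib-+ ys (F x) _))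

  ∑-upTo-∷ʳ : ∀ N (f : ℕ → Carrier) → ∑[ i ← upTo (suc N) ] f i ≈ ∑[ i ← upTo N ] f i + f N
  ∑-upTo-∷ʳ N f = begin
    ∑[ i ← upTo (suc N) ] f i         ≡⟨ ≡.cong (λ is → ∑[ i ← is ] f i) (≡.sym (List.upTo-∷ʳ N)) ⟩
    ∑[ i ← upTo N ++ [ N ] ] f i      ≈⟨ ∑-++ (upTo N) [ N ] f ⟩
    ∑[ i ← upTo N ] f i + (f N + 0#)  ≈⟨ +-congˡ (+-identityʳ (f N)) ⟩
    ∑[ i ← upTo N ] f i + f N         ∎

  ∑-upTo-suc : ∀ N (f : ℕ → Carrier) → ∑[ i ← upTo (suc N) ] f i ≡ f 0 + ∑[ i ← upTo N ] f (suc i)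
  ∑-upTo-suc N f = ≡.cong (∑ R) (map-upTo-suc {N = N} f)

  ∑-upTo-shift : ∀ N (f : ℕ → Carrier) → f 0 ≈ 0# → f N ≈ 0# → ∑[ i ← upTo N ] f (suc i) ≈ ∑[ i ← upTo N ] f i
  ∑-upTo-shift N f f0≈0 fN≈0 = begin
    ∑[ i ← upTo N ] f (suc i)         ≈⟨ sym (+-identityˡ _) ⟩
    0# + ∑[ i ← upTo N ] f (suc i)    ≈⟨ +-congʳ (sym f0≈0) ⟩
    f 0 + ∑[ i ← upTo N ] f (suc i)   ≡⟨ ≡.sym (∑-upTo-suc N f) ⟩
    ∑[ i ← upTo (suc N) ] f i         ≈⟨ ∑-upTo-∷ʳ N f ⟩
    ∑[ i ← upTo N ] f i + f N         ≈⟨ +-congˡ fN≈0 ⟩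
    ∑[ i ← upTo N ] f i + 0#          ≈⟨ +-identityʳ _ ⟩
    ∑[ i ← upTo N ] f i               ∎

  ∑-upTo-pairs : ∀ K (f : ℕ → Carrier) → ∑[ j ← upTo (K ℕ.* 2) ] f j ≈ ∑[ i ← upTo K ] (f (i ℕ.* 2) + f (suc (i ℕ.* 2)))
  ∑-upTo-pairs zero    f = refl
  ∑-upTo-pairs (suc K) f = begin
    ∑[ j ← upTo (suc (suc (K ℕ.* 2))) ] f j                      ≡⟨ ∑-upTo-suc (suc (K ℕ.* 2)) f ⟩
    f 0 + ∑[ j ← upTo (suc (K ℕ.* 2)) ] f (suc j)                ≡⟨ ≡.cong (λ y → f 0 + y) (∑-upTo-suc (K ℕ.* 2) (f ∘ suc)) ⟩
    f 0 + (f 1 + ∑[ j ← upTo (K ℕ.* 2) ] f (suc (suc j)))        ≈⟨ sym (+-assoc _ _ _) ⟩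
    (f 0 + f 1) + ∑[ j ← upTo (K ℕ.* 2) ] f (suc (suc j))        ≈⟨ +-congˡ (∑-upTo-pairs K (λ j → f (suc (suc j)))) ⟩
    (f 0 + f 1) + ∑[ i ← upTo K ] (f (suc i ℕ.* 2) + f (suc (suc i ℕ.* 2)))  ≡⟨ ≡.sym (∑-upTo-suc K _) ⟩
    ∑[ i ← upTo (suc K) ] (f (i ℕ.* 2) + f (suc (i ℕ.* 2)))      ∎

  ∑-allFin-suc : ∀ k (f : Fin (suc k) → Carrier) → ∑[ j ← allFin (suc k) ] f j ≡ f zero + ∑[ j ← allFin k ] f (suc j)
  ∑-allFin-suc k f = ≡.cong (∑ R) (map-allFin-suc f)

  ∑-cong-All : ∀ {p} {P : A → Set p} (xs : List A) {f g : A → Carrier} →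
               All P xs → (∀ x → P x → f x ≈ g x) → ∑[ x ← xs ] f x ≈ ∑[ x ← xs ] g x
  ∑-cong-All []       []         f≈g = refl
  ∑-cong-All (x ∷ xs) (px ∷ pxs) f≈g = +-cong (f≈g x px) (∑-cong-All xs pxs f≈g)

  ∏-allFin-suc : ∀ k (f : Fin (suc k) → Carrier) → ∏[ j ← allFin (suc k) ] f j ≡ f zero * ∏[ j ← allFin k ] f (suc j)
  ∏-allFin-suc k f = ≡.cong (∏ R) (map-allFin-suc f)

  if-∧ : ∀ a b x y → (if a ∧ b then x * y else 0#) ≈ (if a then x else 0#) * (if b then y else 0#)
  if-∧ true  true  x y = refl
  if-∧ true  false x y = sym (zeroʳ x)
  if-∧ false b     x y = sym (zeroˡ _)

  ∏-cong : ∀ (xs : List A) {f g : A → Carrier} → (∀ x → f x ≈ g x) → ∏[ x ← xs ] f x ≈ ∏[ x ← xs ] g x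
  ∏-cong []       f≈g = refl
  ∏-cong (x ∷ xs) f≈g = *-cong (f≈g x) (∏-cong xs f≈g)

  ∏-zero : ∀ {xs : List A} {x} (f : A → Carrier) → x ∈ xs → f x ≈ 0# → ∏[ y ← xs ] f y ≈ 0#
  ∏-zero f (here ≡.refl) fx≈0 = trans (*-congʳ fx≈0) (zeroˡ _)
  ∏-zero f (there x∈xs)  fx≈0 = trans (*-congˡ (∏-zero f x∈xs fx≈0)) (zeroʳ _)

  ∑-splits-∷ : ∀ x (l : List A) (φ : List A × List A → Carrier) →
               ∑[ p ← splits (x ∷ l) ] φ p ≈
               ∑[ p ← splits l ] φ (Product.map₁ (x ∷_) p) + ∑[ p ← splits l ] φ (Product.map₂ (x ∷_) p)
  ∑-splits-∷ x l φ = trans (∑-++ (map (Product.map₁ (x ∷_)) (splits l)) _ φ)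
                           (+-cong (reflexive (∑-map (splits l) _ φ)) (reflexive (∑-map (splits l) _ φ)))

T-suc : ∀ m → T (suc m) ≡ + 1 ℤ.- sumℤ (map (λ i → + ((2 ℕ.* m ℕ.+ 1) C (2 ℕ.* toℕ i ℕ.+ 1)) ℤ.* lookup (Ts m) i) (allFin m))
T-suc m = Vec.last-∷ʳ _ (Ts m)

lookup-Ts : ∀ m (i : Fin m) → lookup (Ts m) i ≡ T (suc (toℕ i))
lookup-Ts (suc m) i with view i
... | ‵fromℕ     = ≡.trans (lookup-∷ʳ-fromℕ (Ts m) _) (≡.trans (≡.sym (T-suc m)) (≡.cong (T ∘ suc) (≡.sym (Fin.toℕ-fromℕ m))))
... | ‵inject₁ j = ≡.trans (lookup-∷ʳ-inject₁ (Ts m) _ j) (≡.trans (lookup-Ts m j) (≡.cong (T ∘ suc) (≡.sym (Fin.toℕ-inject₁ j))))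

module CanonicalMaps {c ℓ} (R : CommutativeRing c ℓ) where
  open CommutativeRing R hiding (zero)
  open Sums R
  open import Relation.Binary.Reasoning.Setoid setoid
  open import Algebra.Properties.Group +-group using (ε⁻¹≈ε; ⁻¹-involutive)
  open import Algebra.Properties.AbelianGroup +-abelianGroup using (⁻¹-∙-comm)
  open import Algebra.Properties.CommutativeSemigroup +-commutativeSemigroup using (interchange)

  ℕ→R-+ : ∀ m n → ℕ→R R (m ℕ.+ n) ≈ ℕ→R R m + ℕ→R R n
  ℕ→R-+ zero    n = sym (+-identityˡ _)
  ℕ→R-+ (suc m) n = trans (+-congˡ (ℕ→R-+ m n)) (sym (+-assoc _ _ _))

  ℕ→R-1 : ℕ→R R 1 ≈ 1#
  ℕ→R-1 = +-identityʳ 1#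

  ℤ→R-⊖ : ∀ m n → ℤ→R R (m ℤ.⊖ n) ≈ ℕ→R R m - ℕ→R R n
  ℤ→R-⊖ m       zero    = sym (trans (+-congˡ ε⁻¹≈ε) (+-identityʳ _))
  ℤ→R-⊖ zero    (suc n) = sym (+-identityˡ _)
  ℤ→R-⊖ (suc m) (suc n) = begin
    ℤ→R R (suc m ℤ.⊖ suc n)           ≡⟨ ≡.cong (ℤ→R R) (ℤ.[1+m]⊖[1+n]≡m⊖n m n) ⟩
    ℤ→R R (m ℤ.⊖ n)                   ≈⟨ ℤ→R-⊖ m n ⟩
    ℕ→R R m - ℕ→R R n                 ≈⟨ sym (+-identityˡ _) ⟩
    0# + (ℕ→R R m - ℕ→R R n)          ≈⟨ +-congʳ (sym (-‿inverseʳ 1#)) ⟩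
    (1# - 1#) + (ℕ→R R m - ℕ→R R n)   ≈⟨ interchange 1# (- 1#) _ _ ⟩
    ℕ→R R (suc m) + (- 1# - ℕ→R R n)  ≈⟨ +-congˡ (⁻¹-∙-comm 1# _) ⟩
    ℕ→R R (suc m) - ℕ→R R (suc n)     ∎

  ℤ→R-+ : ∀ x y → ℤ→R R (x ℤ.+ y) ≈ ℤ→R R x + ℤ→R R y
  ℤ→R-+ -[1+ m ] -[1+ n ] = begin
    - ℕ→R R (suc (suc (m ℕ.+ n)))         ≡⟨ ≡.cong (λ k → - ℕ→R R (suc k)) (≡.sym (ℕ.+-suc m n)) ⟩
    - ℕ→R R (suc m ℕ.+ suc n)             ≈⟨ -‿cong (ℕ→R-+ (suc m) (suc n)) ⟩
    - (ℕ→R R (suc m) + ℕ→R R (suc n))     ≈⟨ sym (⁻¹-∙-comm _ _) ⟩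
    - ℕ→R R (suc m) - ℕ→R R (suc n)       ∎
  ℤ→R-+ -[1+ m ] (+ n)    = trans (ℤ→R-⊖ n (suc m)) (+-comm _ _)
  ℤ→R-+ (+ m)    -[1+ n ] = ℤ→R-⊖ m (suc n)
  ℤ→R-+ (+ m)    (+ n)    = ℕ→R-+ m n

  ℤ→R-neg : ∀ x → ℤ→R R (ℤ.- x) ≈ - ℤ→R R x
  ℤ→R-neg (+ zero)  = sym ε⁻¹≈ε
  ℤ→R-neg (+ suc n) = refl
  ℤ→R-neg -[1+ n ]  = sym (⁻¹-involutive _)

  ℤ→R-ℕ* : ∀ m x → ℤ→R R (+ m ℤ.* x) ≈ ℕ→R R m * ℤ→R R x
  ℤ→R-ℕ* zero    x = sym (zeroˡ _)
  ℤ→R-ℕ* (suc m) x = begin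
    ℤ→R R (+ suc m ℤ.* x)             ≡⟨ ≡.cong (ℤ→R R) (ℤ.suc-* (+ m) x) ⟩
    ℤ→R R (x ℤ.+ + m ℤ.* x)           ≈⟨ ℤ→R-+ x (+ m ℤ.* x) ⟩
    ℤ→R R x + ℤ→R R (+ m ℤ.* x)       ≈⟨ +-cong (sym (*-identityˡ _)) (ℤ→R-ℕ* m x) ⟩
    1# * ℤ→R R x + ℕ→R R m * ℤ→R R x  ≈⟨ sym (distribʳ _ _ _) ⟩
    ℕ→R R (suc m) * ℤ→R R x           ∎

  ℤ→R-sum : ∀ xs → ℤ→R R (sumℤ xs) ≈ ∑[ x ← xs ] ℤ→R R x
  ℤ→R-sum []       = refl
  ℤ→R-sum (x ∷ xs) = trans (ℤ→R-+ x (sumℤ xs)) (+-congˡ (ℤ→R-sum xs))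

module TangentWeights {c ℓ} (R : CommutativeRing c ℓ) where
  open CommutativeRing R hiding (zero)
  open Sums R
  open CanonicalMaps R
  open import Relation.Binary.Reasoning.Setoid setoid
  open import Algebra.Properties.CommutativeSemigroup +-commutativeSemigroup using (x∙yz≈y∙xz)

  T-recurrence : ∀ m → ∑[ i ← upTo (suc m) ] (ℕ→R R (suc (m ℕ.* 2) C suc (i ℕ.* 2)) * ℤ→R R (T (suc i))) ≈ 1#
  T-recurrence m = begin
    ∑[ i ← upTo (suc m) ] f i   ≈⟨ ∑-upTo-∷ʳ m f ⟩
    ∑[ i ← upTo m ] f i + f m   ≈⟨ +-congˡ last-term ⟩
    s + (1# - s)                ≈⟨ x∙yz≈y∙xz s 1# (- s) ⟩
    1# + (s - s)                ≈⟨ +-congˡ (-‿inverseʳ s) ⟩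
    1# + 0#                     ≈⟨ +-identityʳ 1# ⟩
    1#                          ∎
    where
    f : ℕ → Carrier
    f i = ℕ→R R (suc (m ℕ.* 2) C suc (i ℕ.* 2)) * ℤ→R R (T (suc i))
    s : Carrier
    s = ∑[ i ← upTo m ] f i
    2n+1≡1+n*2 : ∀ n → 2 ℕ.* n ℕ.+ 1 ≡ suc (n ℕ.* 2)
    2n+1≡1+n*2 n = ≡.trans (ℕ.+-comm (2 ℕ.* n) 1) (≡.cong suc (ℕ.*-comm 2 n))
    binom : Fin m → ℕ
    binom i = (2 ℕ.* m ℕ.+ 1) C (2 ℕ.* toℕ i ℕ.+ 1)
    summand : Fin m → ℤ
    summand i = + binom i ℤ.* lookup (Ts m) i
    t : ℤ
    t = sumℤ (map summand (allFin m))
    tail≈s : ℤ→R R t ≈ s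
    tail≈s = begin
      ℤ→R R t                                 ≈⟨ ℤ→R-sum (map summand (allFin m)) ⟩
      ∑[ x ← map summand (allFin m) ] ℤ→R R x  ≡⟨ ∑-map (allFin m) summand (ℤ→R R) ⟩
      ∑[ i ← allFin m ] ℤ→R R (summand i)     ≈⟨ ∑-cong (allFin m) (λ i → trans (ℤ→R-ℕ* (binom i) (lookup (Ts m) i)) (reflexive
                                                    (≡.cong₂ (λ a b → ℕ→R R a * ℤ→R R b)
                                                       (≡.cong₂ _C_ (2n+1≡1+n*2 m) (2n+1≡1+n*2 (toℕ i))) (lookup-Ts m i)))) ⟩
      ∑[ i ← allFin m ] f (toℕ i)             ≡⟨ ≡.cong (∑ R) (map-allFin-toℕ {k = m} f) ⟩
      s                                       ∎
    last-term : f m ≈ 1# - s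
    last-term = begin
      f m                          ≡⟨ ≡.cong₂ (λ a b → ℕ→R R a * ℤ→R R b) (nCn≡1 (suc (m ℕ.* 2))) (T-suc m) ⟩
      ℕ→R R 1 * ℤ→R R (+ 1 ℤ.- t)  ≈⟨ trans (*-congʳ ℕ→R-1) (*-identityˡ _) ⟩
      ℤ→R R (+ 1 ℤ.- t)            ≈⟨ trans (ℤ→R-+ (+ 1) (ℤ.- t)) (+-cong ℕ→R-1 (ℤ→R-neg t)) ⟩
      1# - ℤ→R R t                 ≈⟨ +-congˡ (-‿cong tail≈s) ⟩
      1# - s                       ∎

  -- ∑Subsets N ψ is the sum of ψ |S| over all subsets S of an N-element set.
  ∑Subsets : ℕ → (ℕ → Carrier) → Carrier
  ∑Subsets zero    ψ = ψ 0
  ∑Subsets (suc N) ψ = ∑Subsets N (ψ ∘ suc) + ∑Subsets N ψ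

  ∑Subsets-cong : ∀ N {ψ χ : ℕ → Carrier} → (∀ j → ψ j ≈ χ j) → ∑Subsets N ψ ≈ ∑Subsets N χ
  ∑Subsets-cong zero    ψ≈χ = ψ≈χ 0
  ∑Subsets-cong (suc N) ψ≈χ = +-cong (∑Subsets-cong N (ψ≈χ ∘ suc)) (∑Subsets-cong N ψ≈χ)

  ∑Subsets-zero : ∀ N → ∑Subsets N (λ _ → 0#) ≈ 0#
  ∑Subsets-zero zero    = refl
  ∑Subsets-zero (suc N) = trans (+-cong (∑Subsets-zero N) (∑Subsets-zero N)) (+-identityʳ 0#)

  ∑Subsets≈∑binomial : ∀ N ψ → ∑Subsets N ψ ≈ ∑[ j ← upTo (suc N) ] (ℕ→R R (N C j) * ψ j)
  ∑Subsets≈∑binomial zero    ψ = sym (trans (+-identityʳ _) (trans (*-congʳ ℕ→R-1) (*-identityˡ _)))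
  ∑Subsets≈∑binomial (suc N) ψ = begin
    ∑Subsets N (ψ ∘ suc) + ∑Subsets N ψ
      ≈⟨ +-cong (∑Subsets≈∑binomial N (ψ ∘ suc)) (∑Subsets≈∑binomial N ψ) ⟩
    X + ∑[ j ← upTo (suc N) ] (ℕ→R R (N C j) * ψ j)
      ≡⟨ ≡.cong (λ y → X + y) (∑-upTo-suc N _) ⟩
    X + (c₀ + ∑[ j ← upTo N ] g j)              ≈⟨ x∙yz≈y∙xz X c₀ _ ⟩
    c₀ + (X + ∑[ j ← upTo N ] g j)              ≈⟨ +-congˡ (+-congˡ (sym g-extend)) ⟩
    c₀ + (X + ∑[ j ← upTo (suc N) ] g j)        ≈⟨ +-congˡ (sym (∑-distrib-+ (upTo (suc N)) _ g)) ⟩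
    c₀ + ∑[ j ← upTo (suc N) ] (ℕ→R R (N C j) * ψ (suc j) + g j)  ≈⟨ +-congˡ (∑-cong (upTo (suc N)) pascal) ⟩
    c₀ + ∑[ j ← upTo (suc N) ] (ℕ→R R (suc N C suc j) * ψ (suc j))  ≡⟨ ≡.sym (∑-upTo-suc (suc N) _) ⟩
    ∑[ j ← upTo (suc (suc N)) ] (ℕ→R R (suc N C j) * ψ j)  ∎
    where
    X c₀ : Carrier
    X = ∑[ j ← upTo (suc N) ] (ℕ→R R (N C j) * ψ (suc j))
    c₀ = ℕ→R R (N C 0) * ψ 0
    g : ℕ → Carrier
    g j = ℕ→R R (N C suc j) * ψ (suc j)
    g-extend : ∑[ j ← upTo (suc N) ] g j ≈ ∑[ j ← upTo N ] g j
    g-extend = begin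
      ∑[ j ← upTo (suc N) ] g j     ≈⟨ ∑-upTo-∷ʳ N g ⟩
      ∑[ j ← upTo N ] g j + g N     ≡⟨ ≡.cong (λ k → ∑[ j ← upTo N ] g j + ℕ→R R k * ψ (suc N)) (k>n⇒nCk≡0 (ℕ.n<1+n N)) ⟩
      ∑[ j ← upTo N ] g j + 0# * ψ (suc N)  ≈⟨ +-congˡ (zeroˡ _) ⟩
      ∑[ j ← upTo N ] g j + 0#      ≈⟨ +-identityʳ _ ⟩
      ∑[ j ← upTo N ] g j           ∎
    pascal : ∀ j → ℕ→R R (N C j) * ψ (suc j) + g j ≈ ℕ→R R (suc N C suc j) * ψ (suc j)
    pascal j = begin
      ℕ→R R (N C j) * ψ (suc j) + ℕ→R R (N C suc j) * ψ (suc j)  ≈⟨ sym (distribʳ _ _ _) ⟩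
      (ℕ→R R (N C j) + ℕ→R R (N C suc j)) * ψ (suc j)           ≈⟨ *-congʳ (sym (ℕ→R-+ (N C j) (N C suc j))) ⟩
      ℕ→R R (N C j ℕ.+ N C suc j) * ψ (suc j)                  ≡⟨ ≡.cong (λ k → ℕ→R R k * ψ (suc j)) (nCk+nC[k+1]≡[n+1]C[k+1] N j) ⟩
      ℕ→R R (suc N C suc j) * ψ (suc j)                        ∎

  blockWeight : ℕ → Carrier
  blockWeight s = if does (2 ∣? s) then ℤ→R R (T ⌊ s /2⌋) else 0#

  blockWeight-even : ∀ {s} → 2 ∣ s → blockWeight s ≡ ℤ→R R (T ⌊ s /2⌋)
  blockWeight-even {s} 2∣s = ≡.cong (λ b → if b then ℤ→R R (T ⌊ s /2⌋) else 0#) (dec-true (2 ∣? s) 2∣s)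

  blockWeight-odd : ∀ {s} → ¬ 2 ∣ s → blockWeight s ≡ 0#
  blockWeight-odd {s} 2∤s = ≡.cong (λ b → if b then ℤ→R R (T ⌊ s /2⌋) else 0#) (dec-false (2 ∣? s) 2∤s)

  ∑Subsets-odd-blockWeight : ∀ m → ∑Subsets (suc (m ℕ.* 2)) (blockWeight ∘ suc) ≈ 1#
  ∑Subsets-odd-blockWeight m = begin
    ∑Subsets N (blockWeight ∘ suc)                               ≈⟨ ∑Subsets≈∑binomial N _ ⟩
    ∑[ j ← upTo (suc m ℕ.* 2) ] f j                              ≈⟨ ∑-upTo-pairs (suc m) f ⟩
    ∑[ i ← upTo (suc m) ] (f (i ℕ.* 2) + f (suc (i ℕ.* 2)))      ≈⟨ ∑-cong (upTo (suc m)) pair ⟩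
    ∑[ i ← upTo (suc m) ] (ℕ→R R (N C suc (i ℕ.* 2)) * ℤ→R R (T (suc i)))  ≈⟨ T-recurrence m ⟩
    1#                                                           ∎
    where
    N : ℕ
    N = suc (m ℕ.* 2)
    f : ℕ → Carrier
    f j = ℕ→R R (N C j) * blockWeight (suc j)
    pair : ∀ i → f (i ℕ.* 2) + f (suc (i ℕ.* 2)) ≈ ℕ→R R (N C suc (i ℕ.* 2)) * ℤ→R R (T (suc i))
    pair i = begin
      f (i ℕ.* 2) + f (suc (i ℕ.* 2))
        ≈⟨ +-cong (trans (*-congˡ (reflexive (blockWeight-odd (2∤1+n*2 i)))) (zeroʳ _))
                  (*-congˡ (reflexive (blockWeight-even (divides (suc i) ≡.refl)))) ⟩
      0# + ℕ→R R (N C suc (i ℕ.* 2)) * ℤ→R R (T ⌊ suc i ℕ.* 2 /2⌋)  ≈⟨ +-identityˡ _ ⟩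
      ℕ→R R (N C suc (i ℕ.* 2)) * ℤ→R R (T ⌊ suc i ℕ.* 2 /2⌋)
        ≡⟨ ≡.cong (λ k → ℕ→R R (N C suc (i ℕ.* 2)) * ℤ→R R (T k)) (⌊n*2/2⌋≡n (suc i)) ⟩
      ℕ→R R (N C suc (i ℕ.* 2)) * ℤ→R R (T (suc i))                 ∎

allPartitions-empty : ∀ m k → m < k → allPartitions m k ≡ []
allPartitions-empty zero    (suc k) _         = ≡.refl
allPartitions-empty (suc m) (suc k) (s≤s m<k)
  rewrite allPartitions-empty m k m<k | allPartitions-empty m (suc k) (ℕ.m<n⇒m<1+n m<k) = ≡.refl

module PartitionSums {c ℓ} (R : CommutativeRing c ℓ) where
  open CommutativeRing R hiding (zero)
  open Sums R
  open import Relation.Binary.Reasoning.Setoid setoid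

  ∑Partitions-cong : ∀ m {F G : ∀ {k} → SetPartition m k → Carrier} →
                     (∀ {k} (π : SetPartition m k) → F π ≈ G π) → ∑Partitions R m F ≈ ∑Partitions R m G
  ∑Partitions-cong m F≈G = ∑-cong (upTo (suc m)) (λ k → ∑-cong (allPartitions m k) F≈G)

  *-distribˡ-∑Partitions : ∀ m a (F : ∀ {k} → SetPartition m k → Carrier) →
                           a * ∑Partitions R m F ≈ ∑Partitions R m (λ π → a * F π)
  *-distribˡ-∑Partitions m a F = trans (*-distribˡ-∑ (upTo (suc m)) a _)
                                       (∑-cong (upTo (suc m)) (λ k → *-distribˡ-∑ (allPartitions m k) a F))

  ∑Partitions-comm : ∀ m (xs : List A) (F : ∀ {k} → A → SetPartition m k → Carrier) →
                     ∑Partitions R m (λ π → ∑[ x ← xs ] F x π) ≈ ∑[ x ← xs ] ∑Partitions R m (F x)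
  ∑Partitions-comm m xs F = trans (∑-cong (upTo (suc m)) (λ k → ∑-comm (allPartitions m k) xs (λ π x → F x π)))
                                  (∑-comm (upTo (suc m)) xs _)

  ∑Partitions-suc : ∀ m (F : ∀ {k} → SetPartition (suc m) k → Carrier) →
                    ∑Partitions R (suc m) F ≈ ∑Partitions R m (λ {k} π → F (new π) + ∑[ j ← allFin k ] F (old π j))
  ∑Partitions-suc m F = begin
    ∑Partitions R (suc m) F                               ≡⟨ ∑-upTo-suc (suc m) _ ⟩
    0# + ∑[ k ← upTo (suc m) ] ∑[ π ← allPartitions (suc m) (suc k) ] F π
                                                          ≈⟨ +-identityˡ _ ⟩
    ∑[ k ← upTo (suc m) ] ∑[ π ← allPartitions (suc m) (suc k) ] F π
                                                          ≈⟨ ∑-cong (upTo (suc m)) split ⟩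
    ∑[ k ← upTo (suc m) ] (NewBlock k + OldBlock (suc k))  ≈⟨ ∑-distrib-+ (upTo (suc m)) NewBlock (OldBlock ∘ suc) ⟩
    ∑[ k ← upTo (suc m) ] NewBlock k + ∑[ k ← upTo (suc m) ] OldBlock (suc k)
                                                          ≈⟨ +-congˡ (∑-upTo-shift (suc m) OldBlock OldBlock-0 OldBlock-suc-m) ⟩
    ∑[ k ← upTo (suc m) ] NewBlock k + ∑[ k ← upTo (suc m) ] OldBlock k
                                                          ≈⟨ sym (∑-distrib-+ (upTo (suc m)) NewBlock OldBlock) ⟩
    ∑[ k ← upTo (suc m) ] (NewBlock k + OldBlock k)        ≈⟨ ∑-cong (upTo (suc m)) (λ k → sym (∑-distrib-+ (allPartitions m k) _ _)) ⟩
    ∑Partitions R m (λ {k} π → F (new π) + ∑[ j ← allFin k ] F (old π j))  ∎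
    where
    NewBlock OldBlock : ℕ → Carrier
    NewBlock k = ∑[ π ← allPartitions m k ] F (new π)
    OldBlock k = ∑[ π ← allPartitions m k ] ∑[ j ← allFin k ] F (old π j)
    OldBlock-0 : OldBlock 0 ≈ 0#
    OldBlock-0 = ∑-zero (allPartitions m 0)
    OldBlock-suc-m : OldBlock (suc m) ≈ 0#
    OldBlock-suc-m = reflexive (≡.cong (λ πs → ∑[ π ← πs ] ∑[ j ← allFin (suc m) ] F (old π j))
                                       (allPartitions-empty m (suc m) ℕ.≤-refl))
    split : ∀ k → ∑[ π ← allPartitions (suc m) (suc k) ] F π ≈ NewBlock k + OldBlock (suc k)
    split k = begin
      ∑[ π ← allPartitions (suc m) (suc k) ] F π            ≈⟨ ∑-++ (map new (allPartitions m k)) _ F ⟩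
      ∑[ π ← map new (allPartitions m k) ] F π
        + ∑[ π ← concatMap (λ π → map (old π) (allFin (suc k))) (allPartitions m (suc k)) ] F π
                                                           ≈⟨ +-cong (reflexive (∑-map (allPartitions m k) new F))
                                                                     (∑-concatMap (allPartitions m (suc k)) _ F) ⟩
      NewBlock k + ∑[ π ← allPartitions m (suc k) ] ∑[ ρ ← map (old π) (allFin (suc k)) ] F ρ
                                                           ≈⟨ +-congˡ (∑-cong (allPartitions m (suc k))
                                                                (λ π → reflexive (∑-map (allFin (suc k)) (old π) F))) ⟩
      NewBlock k + OldBlock (suc k)                        ∎

indicator : Fin k → Fin k → ℕ
indicator a b = if does (a ≟ b) then 1 else 0

indicator-refl : (a : Fin k) → indicator a a ≡ 1
indicator-refl a = ≡.cong (λ b → if b then 1 else 0) (dec-true (a ≟ a) ≡.refl)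

indicator-≢ : {a b : Fin k} → a ≢ b → indicator a b ≡ 0
indicator-≢ {a = a} {b} a≢b = ≡.cong (λ b → if b then 1 else 0) (dec-false (a ≟ b) a≢b)

indicator-inject₁ : (a b : Fin k) → indicator (inject₁ a) (inject₁ b) ≡ indicator a b
indicator-inject₁ a b with a ≟ b
... | yes ≡.refl = indicator-refl (inject₁ a)
... | no a≢b     = indicator-≢ (a≢b ∘ Fin.inject₁-injective)

sumℕ-allFin-suc : (f : Fin (suc k) → ℕ) → sumℕ (map f (allFin (suc k))) ≡ f zero ℕ.+ sumℕ (map (f ∘ suc) (allFin k))
sumℕ-allFin-suc f = ≡.cong sumℕ (map-allFin-suc f)

blockSize-new-fromℕ : (π : SetPartition m k) → blockSize (new π) (fromℕ k) ≡ 1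
blockSize-new-fromℕ {m} {k} π = begin
  blockSize (new π) (fromℕ k)                                          ≡⟨ sumℕ-allFin-suc (λ i → indicator (block (new π) i) (fromℕ k)) ⟩
  indicator (fromℕ k) (fromℕ k) ℕ.+ sumℕ (map (λ i → indicator (inject₁ (block π i)) (fromℕ k)) (allFin m))
    ≡⟨ ≡.cong₂ ℕ._+_ (indicator-refl (fromℕ k))
                     (≡.cong sumℕ (List.map-cong (λ i → indicator-≢ (Fin.fromℕ≢inject₁ {i = block π i} ∘ ≡.sym)) (allFin m))) ⟩
  1 ℕ.+ sumℕ (map (λ _ → 0) (allFin m))                                ≡⟨ ≡.cong suc (sumℕ-zeros (allFin m)) ⟩
  1                                                                    ∎
  where
  open ≡.≡-Reasoning
  sumℕ-zeros : (xs : List A) → sumℕ (map (λ _ → 0) xs) ≡ 0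
  sumℕ-zeros []       = ≡.refl
  sumℕ-zeros (x ∷ xs) = sumℕ-zeros xs

blockSize-new-inject₁ : (π : SetPartition m k) (j : Fin k) → blockSize (new π) (inject₁ j) ≡ blockSize π j
blockSize-new-inject₁ {m} {k} π j = begin
  blockSize (new π) (inject₁ j)                                         ≡⟨ sumℕ-allFin-suc (λ i → indicator (block (new π) i) (inject₁ j)) ⟩
  indicator (fromℕ k) (inject₁ j) ℕ.+ sumℕ (map (λ i → indicator (inject₁ (block π i)) (inject₁ j)) (allFin m))
    ≡⟨ ≡.cong₂ ℕ._+_ (indicator-≢ (Fin.fromℕ≢inject₁ {i = j}))
                     (≡.cong sumℕ (List.map-cong (λ i → indicator-inject₁ (block π i) j) (allFin m))) ⟩
  blockSize π j                                                         ∎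
  where open ≡.≡-Reasoning

blockSize-old : (π : SetPartition m k) (j₀ j : Fin k) → blockSize (old π j₀) j ≡ indicator j₀ j ℕ.+ blockSize π j
blockSize-old π j₀ j = sumℕ-allFin-suc (λ i → indicator (block (old π j₀) i) j)

record Block (n : ℕ) : Set where
  constructor mkBlock
  field
    size       : ℕ
    colour     : Fin n
    monochrome : Bool
open Block public

module _ {n : ℕ} where

  singleton : Fin n → Block n
  singleton c = mkBlock 1 c true

  insert : Fin n → Block n → Block n
  insert d B = mkBlock (suc (size B)) (colour B) (does (d ≟ colour B) ∧ monochrome B)

  insertAll : List (Fin n) → Block n → Block n
  insertAll S B = List.foldr insert B S

  insert-comm : ∀ d e B → insert d (insert e B) ≡ insert e (insert d B)
  insert-comm d e B = ≡.cong (mkBlock _ (colour B)) (∧-swap (does (d ≟ colour B)) (does (e ≟ colour B)) (monochrome B))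
    where
    ∧-swap : ∀ a b c → a ∧ (b ∧ c) ≡ b ∧ (a ∧ c)
    ∧-swap true  b c = ≡.refl
    ∧-swap false true  c = ≡.refl
    ∧-swap false false c = ≡.refl

  insertAll-insert : ∀ S d B → insertAll S (insert d B) ≡ insert d (insertAll S B)
  insertAll-insert []      d B = ≡.refl
  insertAll-insert (e ∷ S) d B = ≡.trans (≡.cong (insert e) (insertAll-insert S d B)) (insert-comm e d (insertAll S B))

  size-insertAll : ∀ S B → size (insertAll S B) ≡ length S ℕ.+ size B
  size-insertAll []      B = ≡.refl
  size-insertAll (d ∷ S) B = ≡.cong suc (size-insertAll S B)

  colour-insertAll : ∀ S B → colour (insertAll S B) ≡ colour B
  colour-insertAll []      B = ≡.refl
  colour-insertAll (d ∷ S) B = colour-insertAll S B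

  monochrome-insert : ∀ {d B} → monochrome (insert d B) ≡ true → d ≡ colour B × monochrome B ≡ true
  monochrome-insert {d} {B} mono with d ≟ colour B | monochrome B
  ... | yes d≡c | true = d≡c , ≡.refl

  insert-monochrome : ∀ {d B} → d ≡ colour B → monochrome B ≡ true → monochrome (insert d B) ≡ true
  insert-monochrome {d} {B} d≡c mono = ≡.cong₂ _∧_ (dec-true (d ≟ colour B) d≡c) mono

  monochrome-insertAll : ∀ S B → monochrome (insertAll S B) ≡ true → All (_≡ colour B) S × monochrome B ≡ true
  monochrome-insertAll []      B mono = [] , mono
  monochrome-insertAll (d ∷ S) B mono =
    let d≡c , mono′ = monochrome-insert {d = d} {B = insertAll S B} mono
        S≡c , B-mono = monochrome-insertAll S B mono′
    in ≡.trans d≡c (colour-insertAll S B) ∷ S≡c , B-mono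

  multiplicity : Fin n → List (Fin n) → ℕ
  multiplicity d []      = 0
  multiplicity d (x ∷ l) = indicator x d ℕ.+ multiplicity d l

  multiplicity-all : ∀ {c} S → All (_≡ c) S → multiplicity c S ≡ length S
  multiplicity-all []      []            = ≡.refl
  multiplicity-all (x ∷ S) (≡.refl ∷ S≡) = ≡.cong₂ ℕ._+_ (indicator-refl x) (multiplicity-all S S≡)

  multiplicity-none : ∀ {c d} S → All (_≡ c) S → d ≢ c → multiplicity d S ≡ 0
  multiplicity-none []      []            d≢c = ≡.refl
  multiplicity-none (x ∷ S) (≡.refl ∷ S≡) d≢c = ≡.cong₂ ℕ._+_ (indicator-≢ (d≢c ∘ ≡.sym)) (multiplicity-none S S≡ d≢c)

  multiplicity-ʳ++ : ∀ d (xs ys : List (Fin n)) → multiplicity d (xs ʳ++ ys) ≡ multiplicity d xs ℕ.+ multiplicity d ys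
  multiplicity-ʳ++ d []       ys = ≡.refl
  multiplicity-ʳ++ d (x ∷ xs) ys = ≡.trans (multiplicity-ʳ++ d xs (x ∷ ys)) (ℕ+.x∙yz≈yx∙z (multiplicity d xs) (indicator x d) _)

  EvenMultiplicities : List (Fin n) → Set
  EvenMultiplicities l = ∀ d → 2 ∣ multiplicity d l

IsSplitOf : ∀ {n} → List (Fin n) → List (Fin n) × List (Fin n) → Set
IsSplitOf l (S , Q) = (∀ d → multiplicity d l ≡ multiplicity d S ℕ.+ multiplicity d Q) × length Q ≤ length l

splits-sound : ∀ {n} (l : List (Fin n)) → All (IsSplitOf l) (splits l)
splits-sound []      = ((λ d → ≡.refl) , z≤n) ∷ []
splits-sound (x ∷ l) = All.++⁺ (All.map⁺ (All.map (λ {p} → left {p}) (splits-sound l)))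
                               (All.map⁺ (All.map (λ {p} → right {p}) (splits-sound l)))
  where
  left : ∀ {p} → IsSplitOf l p → IsSplitOf (x ∷ l) (Product.map₁ (x ∷_) p)
  left {S , Q} (mult , len) =
    (λ d → ≡.trans (≡.cong (indicator x d ℕ.+_) (mult d)) (≡.sym (ℕ.+-assoc (indicator x d) _ _))) , ℕ.m≤n⇒m≤1+n len
  right : ∀ {p} → IsSplitOf l p → IsSplitOf (x ∷ l) (Product.map₂ (x ∷_) p)
  right {S , Q} (mult , len) =
    (λ d → ≡.trans (≡.cong (indicator x d ℕ.+_) (mult d)) (ℕ+.x∙yz≈y∙xz (indicator x d) (multiplicity d S) _)) , s≤s len

even-complement : ∀ {n} {c : Fin n} r S Q → EvenMultiplicities (c ∷ r) → IsSplitOf r (S , Q) →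
                  All (_≡ c) S → 2 ∣ length S ℕ.+ 1 → EvenMultiplicities Q
even-complement {c = c} r S Q even (mult , _) S≡c 2∣|S|+1 d with d ≟ c
... | yes ≡.refl = ∣m+n∣m⇒∣n (≡.subst (2 ∣_) c-count (even c)) 2∣|S|+1
  where
  c-count : indicator c c ℕ.+ multiplicity c r ≡ (length S ℕ.+ 1) ℕ.+ multiplicity c Q
  c-count rewrite indicator-refl c | mult c | multiplicity-all S S≡c | ℕ.+-comm (length S) 1 = ≡.refl
... | no d≢c = ≡.subst (2 ∣_) d-count (even d)
  where
  d-count : indicator c d ℕ.+ multiplicity d r ≡ multiplicity d Q
  d-count rewrite indicator-≢ (d≢c ∘ ≡.sym) | mult d | multiplicity-none S S≡c d≢c = ≡.refl

state : ∀ {n} → (Fin m → Fin n) → SetPartition m k → Vec (Block n) k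
state t ∅         = []
state t (new π)   = state (t ∘ suc) π ∷ʳ singleton (t zero)
state t (old π j) = updateAt (state (t ∘ suc) π) j (insert (t zero))

module _ {n : ℕ} (t : Fin (suc m) → Fin n) (π : SetPartition m k) where

  lookup-state-new-fromℕ : lookup (state t (new π)) (fromℕ k) ≡ singleton (t zero)
  lookup-state-new-fromℕ = lookup-∷ʳ-fromℕ (state (t ∘ suc) π) (singleton (t zero))

  lookup-state-new-inject₁ : ∀ j → lookup (state t (new π)) (inject₁ j) ≡ lookup (state (t ∘ suc) π) j
  lookup-state-new-inject₁ = lookup-∷ʳ-inject₁ (state (t ∘ suc) π) (singleton (t zero))

  lookup-state-old : ∀ j → lookup (state t (old π j)) j ≡ insert (t zero) (lookup (state (t ∘ suc) π) j)
  lookup-state-old j = Vec.lookup∘updateAt j (state (t ∘ suc) π)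

  lookup-state-old-≢ : ∀ {j₀ j} → j₀ ≢ j → lookup (state t (old π j₀)) j ≡ lookup (state (t ∘ suc) π) j
  lookup-state-old-≢ {j₀} {j} j₀≢j = Vec.lookup∘updateAt′ j j₀ (j₀≢j ∘ ≡.sym) (state (t ∘ suc) π)

module _ {n : ℕ} where
  open ≡.≡-Reasoning

  size-state : ∀ (t : Fin m → Fin n) (π : SetPartition m k) j → size (lookup (state t π) j) ≡ blockSize π j
  size-state t (new π) j with view j
  ... | ‵fromℕ = ≡.trans (≡.cong size (lookup-state-new-fromℕ t π)) (≡.sym (blockSize-new-fromℕ π))
  ... | ‵inject₁ j = begin
    size (lookup (state t (new π)) (inject₁ j))  ≡⟨ ≡.cong size (lookup-state-new-inject₁ t π j) ⟩
    size (lookup (state (t ∘ suc) π) j)          ≡⟨ size-state (t ∘ suc) π j ⟩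
    blockSize π j                                ≡⟨ blockSize-new-inject₁ π j ⟨
    blockSize (new π) (inject₁ j)                ∎
  size-state t (old π j₀) j = ≡.trans (size-old (j₀ ≟ j)) (≡.sym (blockSize-old π j₀ j))
    where
    size-old : Dec (j₀ ≡ j) → size (lookup (state t (old π j₀)) j) ≡ indicator j₀ j ℕ.+ blockSize π j
    size-old (yes ≡.refl) = begin
      size (lookup (state t (old π j₀)) j₀)  ≡⟨ ≡.cong size (lookup-state-old t π j₀) ⟩
      suc (size (lookup (state (t ∘ suc) π) j₀))  ≡⟨ ≡.cong suc (size-state (t ∘ suc) π j₀) ⟩
      1 ℕ.+ blockSize π j₀                   ≡⟨ ≡.cong (ℕ._+ blockSize π j₀) (indicator-refl j₀) ⟨
      indicator j₀ j₀ ℕ.+ blockSize π j₀     ∎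
    size-old (no j₀≢j) = begin
      size (lookup (state t (old π j₀)) j)   ≡⟨ ≡.cong size (lookup-state-old-≢ t π j₀≢j) ⟩
      size (lookup (state (t ∘ suc) π) j)    ≡⟨ size-state (t ∘ suc) π j ⟩
      0 ℕ.+ blockSize π j                    ≡⟨ ≡.cong (ℕ._+ blockSize π j) (indicator-≢ j₀≢j) ⟨
      indicator j₀ j ℕ.+ blockSize π j       ∎

  colour-state-old : ∀ (t : Fin (suc m) → Fin n) (π : SetPartition m k) j₀ j →
                     colour (lookup (state t (old π j₀)) j) ≡ colour (lookup (state (t ∘ suc) π) j)
  colour-state-old t π j₀ j with j₀ ≟ j
  ... | yes ≡.refl = ≡.cong colour (lookup-state-old t π j₀)
  ... | no j₀≢j    = ≡.cong colour (lookup-state-old-≢ t π j₀≢j)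

  colour-state : ∀ (t : Fin m → Fin n) (π : SetPartition m k) j → ∃ λ i → block π i ≡ j × t i ≡ colour (lookup (state t π) j)
  colour-state t (new π) j with view j
  ... | ‵fromℕ     = zero , ≡.refl , ≡.cong colour (≡.sym (lookup-state-new-fromℕ t π))
  ... | ‵inject₁ j = let i , i∈j , tᵢ≡c = colour-state (t ∘ suc) π j
                     in suc i , ≡.cong inject₁ i∈j , ≡.trans tᵢ≡c (≡.cong colour (≡.sym (lookup-state-new-inject₁ t π j)))
  colour-state t (old π j₀) j =
    let i , i∈j , tᵢ≡c = colour-state (t ∘ suc) π j
    in suc i , i∈j , ≡.trans tᵢ≡c (≡.sym (colour-state-old t π j₀ j))

  monochrome⇒constant : ∀ (t : Fin m → Fin n) (π : SetPartition m k) j → monochrome (lookup (state t π) j) ≡ true →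
                        ∀ i → block π i ≡ j → t i ≡ colour (lookup (state t π) j)
  monochrome⇒constant t (new π) j mono i i∈j with view j
  monochrome⇒constant t (new π) _ mono zero    i∈j | ‵fromℕ     = ≡.cong colour (≡.sym (lookup-state-new-fromℕ t π))
  monochrome⇒constant t (new π) _ mono (suc i) i∈j | ‵fromℕ     = ⊥-elim (Fin.fromℕ≢inject₁ (≡.sym i∈j))
  monochrome⇒constant t (new π) _ mono zero    i∈j | ‵inject₁ j = ⊥-elim (Fin.fromℕ≢inject₁ i∈j)
  monochrome⇒constant t (new π) _ mono (suc i) i∈j | ‵inject₁ j =
    ≡.trans (monochrome⇒constant (t ∘ suc) π j (≡.trans (≡.cong monochrome (≡.sym lookup-j)) mono) i (Fin.inject₁-injective i∈j))
            (≡.cong colour (≡.sym lookup-j))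
    where
    lookup-j : lookup (state t (new π)) (inject₁ j) ≡ lookup (state (t ∘ suc) π) j
    lookup-j = lookup-state-new-inject₁ t π j
  monochrome⇒constant t (old π j₀) j mono i i∈j with j₀ ≟ j
  ... | yes ≡.refl = ≡.trans (joined i i∈j) (≡.sym (colour-state-old t π j₀ j₀))
    where
    X : Block n
    X = lookup (state (t ∘ suc) π) j₀
    inserted : t zero ≡ colour X × monochrome X ≡ true
    inserted = monochrome-insert {d = t zero} {B = X} (≡.trans (≡.cong monochrome (≡.sym (lookup-state-old t π j₀))) mono)
    joined : ∀ i → block (old π j₀) i ≡ j₀ → t i ≡ colour X
    joined zero    _   = proj₁ inserted
    joined (suc i) i∈j = monochrome⇒constant (t ∘ suc) π j₀ (proj₂ inserted) i i∈j
  ... | no j₀≢j    = ≡.trans (untouched i i∈j) (≡.sym (colour-state-old t π j₀ j))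
    where
    untouched : ∀ i → block (old π j₀) i ≡ j → t i ≡ colour (lookup (state (t ∘ suc) π) j)
    untouched zero    j₀≡j = ⊥-elim (j₀≢j j₀≡j)
    untouched (suc i) i∈j  =
      monochrome⇒constant (t ∘ suc) π j (≡.trans (≡.cong monochrome (≡.sym (lookup-state-old-≢ t π j₀≢j))) mono) i i∈j

  constant⇒monochrome : ∀ (t : Fin m → Fin n) (π : SetPartition m k) j →
                        (∀ i → block π i ≡ j → t i ≡ colour (lookup (state t π) j)) → monochrome (lookup (state t π) j) ≡ true
  constant⇒monochrome t (new π) j constant with view j
  ... | ‵fromℕ     = ≡.cong monochrome (lookup-state-new-fromℕ t π)
  ... | ‵inject₁ j = ≡.trans (≡.cong monochrome (lookup-state-new-inject₁ t π j))
                       (constant⇒monochrome (t ∘ suc) π j (λ i i∈j → ≡.trans (constant (suc i) (≡.cong inject₁ i∈j))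
                                                                              (≡.cong colour (lookup-state-new-inject₁ t π j))))
  constant⇒monochrome t (old π j₀) j constant with j₀ ≟ j
  ... | yes ≡.refl = ≡.trans (≡.cong monochrome (lookup-state-old t π j₀))
                       (insert-monochrome {d = t zero} {B = lookup (state (t ∘ suc) π) j₀}
                          (≡.trans (constant zero ≡.refl) (colour-state-old t π j₀ j₀))
                          (constant⇒monochrome (t ∘ suc) π j₀ (λ i i∈j → ≡.trans (constant (suc i) i∈j) (colour-state-old t π j₀ j₀))))
  ... | no j₀≢j    = ≡.trans (≡.cong monochrome (lookup-state-old-≢ t π j₀≢j))
                       (constant⇒monochrome (t ∘ suc) π j (λ i i∈j → ≡.trans (constant (suc i) i∈j) (colour-state-old t π j₀ j)))

  ≺⇒monochrome : ∀ (t : Fin m → Fin n) (π : SetPartition m k) → t ≺ π → ∀ j → monochrome (lookup (state t π) j) ≡ true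
  ≺⇒monochrome t π t≺π j = constant⇒monochrome t π j λ i i∈j →
    let w , w∈j , t_w≡c = colour-state t π j in ≡.trans (t≺π i w (≡.trans i∈j (≡.sym w∈j))) t_w≡c

  monochrome⇒≺ : ∀ (t : Fin m → Fin n) (π : SetPartition m k) → (∀ j → monochrome (lookup (state t π) j) ≡ true) → t ≺ π
  monochrome⇒≺ t π mono i i′ same = ≡.trans (constant i ≡.refl) (≡.sym (constant i′ (≡.sym same)))
    where
    constant : ∀ i′ → block π i′ ≡ block π i → t i′ ≡ colour (lookup (state t π) (block π i))
    constant = monochrome⇒constant t π (block π i) (mono (block π i))

module PartitionFunction {c ℓ} (R : CommutativeRing c ℓ) (n : ℕ) where
  open CommutativeRing R hiding (zero)
  open Sums R
  open TangentWeights R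
  open PartitionSums R
  open import Relation.Binary.Reasoning.Setoid setoid
  open import Algebra.Properties.CommutativeSemigroup +-commutativeSemigroup using (x∙yz≈y∙xz)

  weight : Block n → Carrier
  weight B = if monochrome B then blockWeight (size B) else 0#

  -- partitionSum r s places the elements coloured r one after the other into one of the blocks of s
  -- or into a new block, in all possible ways, and sums the products of the resulting block weights.
  partitionSum : List (Fin n) → Vec (Block n) k → Carrier
  partitionSum []      s = ∏[ j ← allFin _ ] weight (lookup s j)
  partitionSum (c ∷ r) s = partitionSum r (s ∷ʳ singleton c) + ∑[ j ← allFin _ ] partitionSum r (updateAt s j (insert c))

  -- Each later element either joins the block B or not, and B does not influence the other blocks.
  partitionSum-∷ : ∀ r B (s : Vec (Block n) k) →
                   partitionSum r (B ∷ s) ≈ ∑[ p ← splits r ] (weight (insertAll (proj₁ p) B) * partitionSum (proj₂ p) s)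
  partitionSum-∷ {k} []      B s = begin
    ∏[ j ← allFin (suc k) ] weight (lookup (B ∷ s) j)  ≡⟨ ∏-allFin-suc k _ ⟩
    weight B * partitionSum [] s                       ≈⟨ +-identityʳ _ ⟨
    weight B * partitionSum [] s + 0#                  ∎
  partitionSum-∷ {k} (c ∷ r) B s = begin
    partitionSum r (B ∷ (s ∷ʳ singleton c)) + ∑[ j ← allFin (suc k) ] partitionSum r (updateAt (B ∷ s) j (insert c))
      ≡⟨ ≡.cong (λ x → partitionSum r (B ∷ (s ∷ʳ singleton c)) + x) (∑-allFin-suc k _) ⟩
    partitionSum r (B ∷ (s ∷ʳ singleton c)) + (partitionSum r (insert c B ∷ s) + Old)
      ≈⟨ x∙yz≈y∙xz _ _ Old ⟩
    partitionSum r (insert c B ∷ s) + (partitionSum r (B ∷ (s ∷ʳ singleton c)) + Old)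
      ≈⟨ +-cong joinsB avoidsB ⟩
    ∑[ p ← splits r ] φ (Product.map₁ (c ∷_) p) + ∑[ p ← splits r ] φ (Product.map₂ (c ∷_) p)
      ≈⟨ ∑-splits-∷ c r φ ⟨
    ∑[ p ← splits (c ∷ r) ] φ p  ∎
    where
    w : List (Fin n) × List (Fin n) → Carrier
    w p = weight (insertAll (proj₁ p) B)
    φ : List (Fin n) × List (Fin n) → Carrier
    φ p = w p * partitionSum (proj₂ p) s
    Old : Carrier
    Old = ∑[ j ← allFin k ] partitionSum r (B ∷ updateAt s j (insert c))
    joinsB : partitionSum r (insert c B ∷ s) ≈ ∑[ p ← splits r ] φ (Product.map₁ (c ∷_) p)
    joinsB = trans (partitionSum-∷ r (insert c B) s)
                   (∑-cong (splits r) (λ p → *-congʳ (reflexive (≡.cong weight (insertAll-insert (proj₁ p) c B)))))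
    avoidsB : partitionSum r (B ∷ (s ∷ʳ singleton c)) + Old ≈ ∑[ p ← splits r ] φ (Product.map₂ (c ∷_) p)
    avoidsB = begin
      partitionSum r (B ∷ (s ∷ʳ singleton c)) + Old
        ≈⟨ +-cong (partitionSum-∷ r B (s ∷ʳ singleton c)) (∑-cong (allFin k) (λ j → partitionSum-∷ r B (updateAt s j (insert c)))) ⟩
      ∑[ p ← splits r ] (w p * partitionSum (proj₂ p) (s ∷ʳ singleton c))
        + ∑[ j ← allFin k ] ∑[ p ← splits r ] (w p * partitionSum (proj₂ p) (updateAt s j (insert c)))
        ≈⟨ +-congˡ (∑-comm (allFin k) (splits r) _) ⟩
      ∑[ p ← splits r ] (w p * partitionSum (proj₂ p) (s ∷ʳ singleton c))
        + ∑[ p ← splits r ] ∑[ j ← allFin k ] (w p * partitionSum (proj₂ p) (updateAt s j (insert c)))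
        ≈⟨ +-congˡ (∑-cong (splits r) (λ p → *-distribˡ-∑ (allFin k) (w p) _)) ⟨
      ∑[ p ← splits r ] (w p * partitionSum (proj₂ p) (s ∷ʳ singleton c))
        + ∑[ p ← splits r ] (w p * ∑[ j ← allFin k ] partitionSum (proj₂ p) (updateAt s j (insert c)))
        ≈⟨ ∑-distrib-+ (splits r) _ _ ⟨
      ∑[ p ← splits r ] (w p * partitionSum (proj₂ p) (s ∷ʳ singleton c)
                          + w p * ∑[ j ← allFin k ] partitionSum (proj₂ p) (updateAt s j (insert c)))
        ≈⟨ ∑-cong (splits r) (λ p → distribˡ (w p) _ _) ⟨
      ∑[ p ← splits r ] φ (Product.map₂ (c ∷_) p)  ∎

  grow : ℕ → Block n → Block n
  grow j B = record B { size = size B ℕ.+ j }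

  ∑-splits-weight : ∀ r B → ∑[ p ← splits r ] weight (insertAll (proj₁ p) B) ≈
                            ∑Subsets (multiplicity (colour B) r) (λ j → weight (grow j B))
  ∑-splits-weight []      B = trans (+-identityʳ _) (reflexive (≡.cong (λ s → weight (record B { size = s })) (≡.sym (ℕ.+-identityʳ (size B)))))
  ∑-splits-weight (x ∷ r) B = begin
    ∑[ p ← splits (x ∷ r) ] weight (insertAll (proj₁ p) B)
      ≈⟨ ∑-splits-∷ x r _ ⟩
    ∑[ p ← splits r ] weight (insert x (insertAll (proj₁ p) B)) + ∑[ p ← splits r ] weight (insertAll (proj₁ p) B)
      ≈⟨ +-cong (∑-cong (splits r) (λ p → reflexive (≡.cong weight (≡.sym (insertAll-insert (proj₁ p) x B)))))
                (∑-splits-weight r B) ⟩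
    ∑[ p ← splits r ] weight (insertAll (proj₁ p) (insert x B)) + ∑Subsets N (ψ B)
      ≈⟨ +-congʳ (∑-splits-weight r (insert x B)) ⟩
    ∑Subsets N (ψ (insert x B)) + ∑Subsets N (ψ B)
      ≈⟨ x-joins-or-not ⟩
    ∑Subsets (indicator x (colour B) ℕ.+ N) (ψ B)  ∎
    where
    N : ℕ
    N = multiplicity (colour B) r
    ψ : Block n → ℕ → Carrier
    ψ B′ j = weight (grow j B′)
    x-joins-or-not : ∑Subsets N (ψ (insert x B)) + ∑Subsets N (ψ B) ≈ ∑Subsets (indicator x (colour B) ℕ.+ N) (ψ B)
    x-joins-or-not with x ≟ colour B
    ... | yes _ = +-congʳ (∑Subsets-cong N (λ j → reflexive (≡.cong (λ s → weight (record B { size = s })) (≡.sym (ℕ.+-suc (size B) j)))))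
    ... | no  _ = trans (+-congʳ (∑Subsets-zero N)) (+-identityˡ _)

  partitionSum-even≈1 : ∀ l → EvenMultiplicities l → partitionSum l [] ≈ 1#
  partitionSum-even≈1 l = bounded (length l) l ℕ.≤-refl
    where
    bounded : ∀ fuel l → length l ≤ fuel → EvenMultiplicities l → partitionSum l [] ≈ 1#
    bounded _          []      _         _    = refl
    bounded (suc fuel) (c ∷ r) (s≤s len) even = begin
      partitionSum r (singleton c ∷ []) + 0#          ≈⟨ +-identityʳ _ ⟩
      partitionSum r (singleton c ∷ [])               ≈⟨ partitionSum-∷ r (singleton c) [] ⟩
      ∑[ p ← splits r ] (weight (insertAll (proj₁ p) (singleton c)) * partitionSum (proj₂ p) [])
                                                      ≈⟨ ∑-cong-All (splits r) (splits-sound r) rest≈1 ⟩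
      ∑[ p ← splits r ] weight (insertAll (proj₁ p) (singleton c))
                                                      ≈⟨ ∑-splits-weight r (singleton c) ⟩
      ∑Subsets (multiplicity c r) (blockWeight ∘ suc) ≡⟨ ≡.cong (λ N → ∑Subsets N (blockWeight ∘ suc)) (proj₂ c-odd) ⟩
      ∑Subsets (suc (proj₁ c-odd ℕ.* 2)) (blockWeight ∘ suc)  ≈⟨ ∑Subsets-odd-blockWeight (proj₁ c-odd) ⟩
      1#                                              ∎
      where
      c-odd : ∃ λ m → multiplicity c r ≡ suc (m ℕ.* 2)
      c-odd = 2∣suc⇒odd (≡.subst (λ i → 2 ∣ i ℕ.+ multiplicity c r) (indicator-refl c) (even c))
      rest≈1 : ∀ p → IsSplitOf r p → weight (insertAll (proj₁ p) (singleton c)) * partitionSum (proj₂ p) [] ≈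
                                     weight (insertAll (proj₁ p) (singleton c))
      rest≈1 (S , Q) split with monochrome (insertAll S (singleton c)) in mono | 2 ∣? size (insertAll S (singleton c))
      ... | false | _         = zeroˡ _
      ... | true  | no 2∤|B|  = trans (*-congʳ odd) (trans (zeroˡ _) (sym odd))
        where
        odd : blockWeight (size (insertAll S (singleton c))) ≈ 0#
        odd = reflexive (blockWeight-odd 2∤|B|)
      ... | true  | yes 2∣|B| = trans (*-congˡ (bounded fuel Q (ℕ.≤-trans (proj₂ split) len) evenQ)) (*-identityʳ _)
        where
        evenQ : EvenMultiplicities Q
        evenQ = even-complement r S Q even split (proj₁ (monochrome-insertAll S (singleton c) mono))
                                (≡.subst (2 ∣_) (size-insertAll S (singleton c)) 2∣|B|)

  tangentWeight : (Fin m → Fin n) → SetPartition m k → Carrier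
  tangentWeight t π = if does (isEvenPartition? π) then (if does (≺? t π) then ∏T R π else 0#) else 0#

  weight-monochrome : ∀ B → monochrome B ≡ true → weight B ≡ blockWeight (size B)
  weight-monochrome B mono = ≡.cong (λ b → if b then blockWeight (size B) else 0#) mono

  weight-polychrome : ∀ B → monochrome B ≢ true → weight B ≡ 0#
  weight-polychrome (mkBlock _ _ false) _    = ≡.refl
  weight-polychrome (mkBlock _ _ true)  poly = ⊥-elim (poly ≡.refl)

  weight-odd : ∀ B → ¬ 2 ∣ size B → weight B ≡ 0#
  weight-odd (mkBlock _ _ false) _   = ≡.refl
  weight-odd (mkBlock _ _ true)  odd = blockWeight-odd odd

  tangentWeight≈partitionSum-state : ∀ (t : Fin m → Fin n) (π : SetPartition m k) → tangentWeight t π ≈ partitionSum [] (state t π)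
  tangentWeight≈partitionSum-state {k = k} t π = by-cases (isEvenPartition? π) (≺? t π)
    where
    st : Fin k → Block n
    st j = lookup (state t π) j
    by-cases : (e : Dec (IsEvenPartition π)) (p : Dec (t ≺ π)) →
               (if does e then (if does p then ∏T R π else 0#) else 0#) ≈ partitionSum [] (state t π)
    by-cases (yes even) (yes t≺π) = ∏-cong (allFin k) λ j → sym (begin
      weight (st j)                       ≡⟨ weight-monochrome (st j) (≺⇒monochrome t π t≺π j) ⟩
      blockWeight (size (st j))           ≡⟨ ≡.cong blockWeight (size-state t π j) ⟩
      blockWeight (blockSize π j)        ≡⟨ blockWeight-even (even j) ⟩
      ℤ→R R (T ⌊ blockSize π j /2⌋)      ∎)
    by-cases (yes _) (no t⊀π) =
      let j , polychrome = Fin.¬∀⟶∃¬ k _ (λ j → monochrome (st j) Bool.≟ true) (t⊀π ∘ monochrome⇒≺ t π)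
      in sym (∏-zero (weight ∘ st) (∈-allFin j) (reflexive (weight-polychrome (st j) polychrome)))
    by-cases (no odd) _ =
      let j , 2∤|B| = Fin.¬∀⟶∃¬ k _ (λ j → 2 ∣? blockSize π j) odd
      in sym (∏-zero (weight ∘ st) (∈-allFin j) (reflexive (weight-odd (st j) (2∤|B| ∘ ≡.subst (2 ∣_) (size-state t π j)))))

  ∑Partitions-state : ∀ m r (t : Fin m → Fin n) → ∑Partitions R m (λ π → partitionSum r (state t π)) ≈ partitionSum (tabulate t ʳ++ r) []
  ∑Partitions-state zero    r t = trans (+-identityʳ _) (+-identityʳ _)
  ∑Partitions-state (suc m) r t = trans (∑Partitions-suc m _) (∑Partitions-state m (t zero ∷ r) (t ∘ suc))

  ∑Partitions-tangentWeight : ∀ (t : Fin m → Fin n) → EvenMultiplicities (tabulate t) → ∑Partitions R m (tangentWeight t) ≈ 1#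
  ∑Partitions-tangentWeight {m} t even = begin
    ∑Partitions R m (tangentWeight t)                          ≈⟨ ∑Partitions-cong m (tangentWeight≈partitionSum-state t) ⟩
    ∑Partitions R m (λ π → partitionSum [] (state t π))        ≈⟨ ∑Partitions-state m [] t ⟩
    partitionSum (tabulate t ʳ++ []) []                        ≈⟨ partitionSum-even≈1 (tabulate t ʳ++ []) reversed-even ⟩
    1#                                                         ∎
    where
    reversed-even : EvenMultiplicities (tabulate t ʳ++ [])
    reversed-even d = ≡.subst (2 ∣_) (≡.sym (≡.trans (multiplicity-ʳ++ d (tabulate t) []) (ℕ.+-identityʳ _))) (even d)

  restrictedSum≈∑tangentWeight : ∀ (ts : List (Fin m → Fin n)) {P : (Fin m → Fin n) → Set} (P? : ∀ t → Dec (P t))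
                         (h : (Fin m → Fin n) → Carrier) (π : SetPartition m k) →
                         (if does (isEvenPartition? π) then ∑[_∣_]_ R ts (λ t → P? t ×-dec ≺? t π) (λ t → h t * ∏T R π) else 0#) ≈
                         ∑[ t ← ts ] ((if does (P? t) then h t else 0#) * tangentWeight t π)
  restrictedSum≈∑tangentWeight ts P? h π = by-cases (isEvenPartition? π)
    where
    by-cases : (e : Dec (IsEvenPartition π)) →
               (if does e then ∑[_∣_]_ R ts (λ t → P? t ×-dec ≺? t π) (λ t → h t * ∏T R π) else 0#) ≈
               ∑[ t ← ts ] ((if does (P? t) then h t else 0#) * (if does e then (if does (≺? t π) then ∏T R π else 0#) else 0#))
    by-cases (yes _) = ∑-cong ts (λ t → if-∧ (does (P? t)) (does (≺? t π)) (h t) (∏T R π))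
    by-cases (no _)  = sym (trans (∑-cong ts (λ t → zeroʳ _)) (∑-zero ts))

  ∑Partitions-guarded-tangentWeight : ∀ (t : Fin m → Fin n) {P : Set} (P? : Dec P) (a : Carrier) → (P → EvenMultiplicities (tabulate t)) →
                         ∑Partitions R m (λ π → (if does P? then a else 0#) * tangentWeight t π) ≈ (if does P? then a else 0#)
  ∑Partitions-guarded-tangentWeight {m} t P? a even = trans (sym (*-distribˡ-∑Partitions m _ (tangentWeight t))) (by-cases P?)
    where
    by-cases : (P? : Dec _) → (if does P? then a else 0#) * ∑Partitions R m (tangentWeight t) ≈ (if does P? then a else 0#)
    by-cases (yes p) = trans (*-congˡ (∑Partitions-tangentWeight t (even p))) (*-identityʳ a)
    by-cases (no _)  = zeroˡ _

multiplicity-tabulate : ∀ {n} d (t : Fin m → Fin n) → multiplicity d (tabulate t) ≡ sum (λ i → indicator (t i) d)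
multiplicity-tabulate {zero}  d t = ≡.refl
multiplicity-tabulate {suc m} d t = ≡.cong (indicator (t zero) d ℕ.+_) (multiplicity-tabulate d (t ∘ suc))

sum-pairs : ∀ q (f : Fin (q ℕ.* 2) → ℕ) → sum f ≡ sum {q} (λ k → f (Fin.combine k zero) ℕ.+ f (Fin.combine k (suc zero)))
sum-pairs zero    f = ≡.refl
sum-pairs (suc q) f = ≡.trans (≡.sym (ℕ.+-assoc (f zero) (f (suc zero)) _))
                              (≡.cong (f zero ℕ.+ f (suc zero) ℕ.+_) (sum-pairs q (λ i → f (suc (suc i)))))

even-multiplicities : ∀ {q n} (t : Tuple q n) → IsEvenTuple {q} {n} t → ∀ d → 2 ∣ multiplicity d (tabulate t)
even-multiplicities {q} t (σ , paired) d = ≡.subst (2 ∣_) (≡.sym count) (2∣n+n (sum g))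
  where
  open ≡.≡-Reasoning
  f : Fin (q ℕ.* 2) → ℕ
  f i = indicator (t i) d
  g : Fin q → ℕ
  g k = f (σ ⟨$⟩ʳ Fin.combine k zero)
  count : multiplicity d (tabulate t) ≡ sum g ℕ.+ sum g
  count = begin
    multiplicity d (tabulate t)            ≡⟨ multiplicity-tabulate d t ⟩
    sum f                                  ≡⟨ ℕΣ.sum-permute f σ ⟩
    sum (f ∘ (σ ⟨$⟩ʳ_))                    ≡⟨ sum-pairs q _ ⟩
    sum (λ k → g k ℕ.+ f (σ ⟨$⟩ʳ Fin.combine k (suc zero)))
                                           ≡⟨ ℕΣ.sum-cong-≗ (λ k → ≡.cong (λ x → g k ℕ.+ indicator x d) (≡.sym (paired k))) ⟩
    sum (λ k → g k ℕ.+ g k)                ≡⟨ ℕΣ.∑-distrib-+ g g ⟩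
    sum g ℕ.+ sum g                        ∎

open import Data.Nat using (_*_)

lemma4p2 : ∀ {c ℓ} (R : CommutativeRing c ℓ) (q n : ℕ) → 1 ≤ q → 1 ≤ n →
    (isEven? : (t : Tuple q n) → Dec (IsEvenTuple {q} {n} t)) →
    (h : Tuple q n → CommutativeRing.Carrier R) →
    CommutativeRing._≈_ R
      (∑[_∣_]_ R (allFuns (q * 2) n) isEven? h)
      (∑Partitions R (q * 2) (λ π →
        if does (isEvenPartition? π) then
          ∑[_∣_]_ R (allFuns (q * 2) n) (λ t → isEven? t ×-dec ≺? t π)
            (λ t → CommutativeRing._*_ R (h t) (∏T R π))
        else CommutativeRing.0# R))
lemma4p2 R q n _ _ isEven? h =
  sym (trans (∑Partitions-cong (q * 2) (restrictedSum≈∑tangentWeight tuples isEven? h))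
      (trans (∑Partitions-comm (q * 2) tuples _)
             (∑-cong tuples (λ t → ∑Partitions-guarded-tangentWeight t (isEven? t) (h t) (even-multiplicities t)))))
  where
  open CommutativeRing R using (sym; trans)
  open Sums R using (∑-cong)
  open PartitionSums R using (∑Partitions-cong; ∑Partitions-comm)
  open PartitionFunction R n using (restrictedSum≈∑tangentWeight; ∑Partitions-guarded-tangentWeight)
  tuples : List (Tuple q n)
  tuples = allFuns (q * 2) n
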